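{- If $G=(V,E)$ is a finite bipartite graph with $m=|E|$ edges, then $v(G)=m+l(G)+2e(G)$.
   Context: $v(G)$ is the minimum number of points of a linear hypergraph (finite point set, lines are subsets of size $\ge2$, two distinct points in at most one line) whose intersection graph (vertices = lines, adjacent iff distinct and intersecting) is isomorphic to $G$. $l(G)$ is the number of vertices of degree $1$ and $e(G)$ the number of isolated vertices. -}

module Defs where

open import Data.Nat using (ℕ; zero; suc; _+_; _*_; _≤_; _<ᵇ_; _≡ᵇ_)
open import Data.Bool using (Bool; true; false; _∧_)
open import Data.Fin using (Fin; toℕ)
open import Data.Fin.Subset using (Subset; _∈_; ∣_∣)
open import Data.List using (List; []; _∷_; map; allFin)
open import Data.Nat.ListAction using (sum)
open import Data.Product using (Σ; _×_; ∃-syntax)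
open import Relation.Binary.PropositionalEquality using (_≡_; _≢_)
open import Function.Bundles using (_↔_; Inverse)

countTrue : List Bool → ℕ
countTrue [] = 0
countTrue (true ∷ bs) = suc (countTrue bs)
countTrue (false ∷ bs) = countTrue bs

record Graph (n : ℕ) : Set where
  field
    adj    : Fin n → Fin n → Bool
    sym    : ∀ i j → adj i j ≡ adj j i
    irrefl : ∀ i → adj i i ≡ false
open Graph public

degree : ∀ {n} → Graph n → Fin n → ℕ
degree {n} G i = countTrue (map (adj G i) (allFin n))

edgeCount : ∀ {n} → Graph n → ℕ
edgeCount {n} G =
  sum (map (λ i → countTrue (map (λ j → (toℕ i <ᵇ toℕ j) ∧ adj G i j) (allFin n))) (allFin n))

leafCount : ∀ {n} → Graph n → ℕ
leafCount {n} G = countTrue (map (λ i → degree G i ≡ᵇ 1) (allFin n))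

isolatedCount : ∀ {n} → Graph n → ℕ
isolatedCount {n} G = countTrue (map (λ i → degree G i ≡ᵇ 0) (allFin n))

Bipartite : ∀ {n} → Graph n → Set
Bipartite {n} G = Σ (Fin n → Bool) λ c → ∀ i j → adj G i j ≡ true → c i ≢ c j

record LinHyp (p k : ℕ) : Set where
  field
    line     : Fin k → Subset p
    distinct : ∀ i j → line i ≡ line j → i ≡ j
    size     : ∀ i → 2 ≤ ∣ line i ∣
    linear   : ∀ (x y : Fin p) → x ≢ y → ∀ i j →
               x ∈ line i → y ∈ line i → x ∈ line j → y ∈ line j → i ≡ j
open LinHyp public

Meets : ∀ {p k} → LinHyp p k → Fin k → Fin k → Set
Meets H i j = i ≢ j × ∃[ x ] (x ∈ line H i × x ∈ line H j)

Realizes : ∀ {p k n} → LinHyp p k → Graph n → Set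
Realizes {k = k} {n = n} H G =
  Σ (Fin k ↔ Fin n) λ φ → ∀ i j →
    (Meets H i j → adj G (Inverse.to φ i) (Inverse.to φ j) ≡ true) ×
    (adj G (Inverse.to φ i) (Inverse.to φ j) ≡ true → Meets H i j)

RealizableOn : ∀ {n} → ℕ → Graph n → Set
RealizableOn p G = Σ ℕ λ k → Σ (LinHyp p k) λ H → Realizes H G

IsV : ∀ {n} → Graph n → ℕ → Set
IsV G v = RealizableOn v G × (∀ p → RealizableOn p G → v ≤ p)

-- Upper bound: take one point for each edge and 2 ∸ deg v spare points for each vertex v, and
-- let the line of v consist of the points of its edges and its own spare points. Each line then
-- has deg v + (2 ∸ deg v) ≥ 2 points, and two lines share a point exactly when their vertices are
-- adjacent, namely the point of that edge. Since Σᵥ (2 ∸ deg v) = l(G) + 2 e(G), this uses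
-- m + l(G) + 2 e(G) points.
-- Lower bound: in any realisation pick a common point of the two lines of every edge, a point
-- lying on no other line for every leaf (its line has a point besides the one shared with its
-- neighbour, and lines meet at most once), and two such points for every isolated vertex. These
-- choices are injective: a private point lies on one line only, and as a bipartite graph has no
-- triangles no point lies on three lines, so a point on two lines determines its edge.

module Submission where

open import Defs
open import Data.Nat using (ℕ; zero; suc; _+_; _*_; _∸_; _≤_; _<ᵇ_; _≡ᵇ_; z≤n; s≤s)
open import Data.Bool using (Bool; true; false; T; not; _∧_)
open import Data.Bool.Properties using (T-∧; T-≡; T-irrelevant; ¬-not; not-involutive)
open import Data.Empty using (⊥-elim)
open import Data.Fin using (Fin; zero; suc; toℕ; _<_; _≟_)
open import Data.Fin.Properties
  using (0↔⊥; 1↔⊤; +↔⊎; ¬Fin0; 0≢1+n; suc-injective; <-cmp; <-asym; <⇒≢; injective⇒≤)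
open import Data.Fin.Subset using (Subset; _∈_; ∣_∣; Nonempty; inside; outside)
open import Data.Fin.Subset.Properties
  using (nonempty?; Empty-unique; ∣⊥∣≡0; x∈p∧x≢y⇒x∈p-y; x∈p⇒∣p-x∣<∣p∣)
open import Data.List using (List; []; _∷_; map; allFin; tabulate)
open import Data.List.Properties using (map-tabulate)
open import Data.Nat.ListAction using (sum)
open import Data.Nat.Properties
  using (≤-trans; ≤-reflexive; ≤-pred; n≮0; 0∸n≡0; m≤n+m∸n; +-assoc; <ᵇ⇒<; <⇒<ᵇ)
open import Data.Nat.Tactic.RingSolver using (solve-∀)
open import Data.Product using (Σ; Σ-syntax; ∃; ∃₂; _×_; _,_; proj₁; proj₂)
open import Data.Product.Function.Dependent.Propositional using (congˡ)
open import Data.Sum using (_⊎_; inj₁; inj₂; swap; [_,_]′)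
open import Data.Sum.Algebra using (⊎-cong)
open import Data.Sum.Properties using (inj₁-injective)
import Data.Vec as Vec
open import Data.Vec using ([]; _∷_; here; there)
open import Data.Vec.Properties using (lookup∘tabulate; []=⇒lookup; lookup⇒[]=)
open import Function using (_∘_; id)
open import Function.Bundles using (_↔_; _⇔_; Inverse; Injection; Equivalence; mk↔ₛ′; mk⇔)
open import Function.Definitions using (Injective)
open import Function.Properties.Inverse using (↔-refl; ↔-sym; ↔-trans; ↔⇒↣)
open import Relation.Binary.Definitions using (Asymmetric; DecidableEquality; tri<; tri≈; tri>)
open import Relation.Binary.PropositionalEquality as ≡ using (_≡_; _≢_; refl; cong; cong₂; subst)
open import Relation.Nullary using (Dec; yes; no; ¬_)
open import Relation.Nullary.Decidable using (isYes; toWitness; fromWitness; _⊎-dec_)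

to-injective : ∀ {A B : Set} (e : A ↔ B) → Injective _≡_ _≡_ (Inverse.to e)
to-injective e = Injection.injective (↔⇒↣ e)

from-injective : ∀ {A B : Set} (e : A ↔ B) → Injective _≡_ _≡_ (Inverse.from e)
from-injective e = to-injective (↔-sym e)

Fin1↔⇒all-equal : ∀ {A : Set} → Fin 1 ↔ A → (a b : A) → a ≡ b
Fin1↔⇒all-equal e a b = begin
  a           ≡⟨ ≡.sym (strictlyInverseˡ a) ⟩
  to (from a) ≡⟨ cong to (Fin1-all-equal (from a) (from b)) ⟩
  to (from b) ≡⟨ strictlyInverseˡ b ⟩
  b           ∎
  where
  open Inverse e
  open ≡.≡-Reasoning
  Fin1-all-equal : (i j : Fin 1) → i ≡ j
  Fin1-all-equal zero zero = refl

injective⇒two-values : ∀ {m} {A : Set} {f : Fin m → A} → Injective _≡_ _≡_ f → 2 ≤ m →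
                       Σ[ a ∈ Fin m ] Σ[ b ∈ Fin m ] f a ≢ f b
injective⇒two-values f-injective (s≤s (s≤s _)) = zero , suc zero , 0≢1+n ∘ f-injective

Σ-Fin-zero↔ : ∀ {B : Fin 0 → Set} → Fin 0 ↔ Σ (Fin 0) B
Σ-Fin-zero↔ = mk↔ₛ′ (λ ()) (λ { (() , _) }) (λ { (() , _) }) (λ ())

Σ-Fin-suc↔ : ∀ {n} {B : Fin (suc n) → Set} → Σ (Fin (suc n)) B ↔ (B zero ⊎ Σ (Fin n) (B ∘ suc))
Σ-Fin-suc↔ {B = B} = mk↔ₛ′ split join split∘join join∘split
  where
  split : Σ _ B → B zero ⊎ Σ _ (B ∘ suc)
  split (zero  , b) = inj₁ b
  split (suc i , b) = inj₂ (i , b)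
  join : B zero ⊎ Σ _ (B ∘ suc) → Σ _ B
  join (inj₁ b)       = zero , b
  join (inj₂ (i , b)) = suc i , b
  split∘join : ∀ y → split (join y) ≡ y
  split∘join (inj₁ _) = refl
  split∘join (inj₂ _) = refl
  join∘split : ∀ x → join (split x) ≡ x
  join∘split (zero  , _) = refl
  join∘split (suc _ , _) = refl

Fin-sum-tabulate↔Σ : ∀ {n} (c : Fin n → ℕ) → Fin (sum (tabulate c)) ↔ Σ (Fin n) (Fin ∘ c)
Fin-sum-tabulate↔Σ {zero}  c = Σ-Fin-zero↔
Fin-sum-tabulate↔Σ {suc n} c =
  ↔-trans +↔⊎ (↔-trans (⊎-cong ↔-refl (Fin-sum-tabulate↔Σ (c ∘ suc))) (↔-sym Σ-Fin-suc↔))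

Fin-countTrue-∷↔ : ∀ b bs → Fin (countTrue (b ∷ bs)) ↔ (T b ⊎ Fin (countTrue bs))
Fin-countTrue-∷↔ true  bs = ↔-trans (+↔⊎ {1}) (⊎-cong 1↔⊤ ↔-refl)
Fin-countTrue-∷↔ false bs = ↔-trans (+↔⊎ {0}) (⊎-cong 0↔⊥ ↔-refl)

Fin-countTrue-tabulate↔Σ : ∀ {n} (h : Fin n → Bool) →
                           Fin (countTrue (tabulate h)) ↔ Σ (Fin n) (T ∘ h)
Fin-countTrue-tabulate↔Σ {zero}  h = Σ-Fin-zero↔
Fin-countTrue-tabulate↔Σ {suc n} h = ↔-trans (Fin-countTrue-∷↔ (h zero) _)
  (↔-trans (⊎-cong ↔-refl (Fin-countTrue-tabulate↔Σ (h ∘ suc))) (↔-sym Σ-Fin-suc↔))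

Fin-sum↔Σ : ∀ {n} (c : Fin n → ℕ) → Fin (sum (map c (allFin n))) ↔ Σ (Fin n) (Fin ∘ c)
Fin-sum↔Σ {n} c = subst (λ s → Fin s ↔ Σ (Fin n) (Fin ∘ c))
  (cong sum (≡.sym (map-tabulate id c))) (Fin-sum-tabulate↔Σ c)

Fin-countTrue↔Σ : ∀ {n} (h : Fin n → Bool) →
                  Fin (countTrue (map h (allFin n))) ↔ Σ (Fin n) (T ∘ h)
Fin-countTrue↔Σ {n} h = subst (λ s → Fin s ↔ Σ (Fin n) (T ∘ h))
  (cong countTrue (≡.sym (map-tabulate id h))) (Fin-countTrue-tabulate↔Σ h)

sum-2∸≡countTrue : ∀ {A : Set} (d : A → ℕ) (xs : List A) →
  sum (map (λ x → 2 ∸ d x) xs) ≡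
  countTrue (map (λ x → d x ≡ᵇ 1) xs) + 2 * countTrue (map (λ x → d x ≡ᵇ 0) xs)
sum-2∸≡countTrue d []       = refl
sum-2∸≡countTrue d (x ∷ xs) = step (d x) _ _ (sum-2∸≡countTrue d xs)
  where
  shift : ∀ a b → 2 + (a + 2 * b) ≡ a + 2 * suc b
  shift = solve-∀
  step : ∀ k {s} bs₁ bs₀ → s ≡ countTrue bs₁ + 2 * countTrue bs₀ →
         2 ∸ k + s ≡ countTrue ((k ≡ᵇ 1) ∷ bs₁) + 2 * countTrue ((k ≡ᵇ 0) ∷ bs₀)
  step 0             bs₁ bs₀ refl = shift (countTrue bs₁) (countTrue bs₀)
  step 1             bs₁ bs₀ refl = refl
  step (suc (suc k)) bs₁ bs₀ refl = cong (_+ (countTrue bs₁ + 2 * countTrue bs₀)) (0∸n≡0 k)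

1≤∣p∣⇒nonempty : ∀ {n} (p : Subset n) → 1 ≤ ∣ p ∣ → Nonempty p
1≤∣p∣⇒nonempty {n} p 1≤∣p∣ with nonempty? p
... | yes ne = ne
... | no p-empty = ⊥-elim (n≮0 (≤-trans 1≤∣p∣ (≤-reflexive ∣p∣≡0)))
  where
  ∣p∣≡0 : ∣ p ∣ ≡ 0
  ∣p∣≡0 = ≡.trans (cong ∣_∣ (Empty-unique p-empty)) (∣⊥∣≡0 n)

2≤∣p∣⇒two-members : ∀ {n} (p : Subset n) → 2 ≤ ∣ p ∣ → ∃₂ λ x y → x ≢ y × x ∈ p × y ∈ p
2≤∣p∣⇒two-members (inside ∷ p) 2≤∣p∣ =
  let y , y∈p = 1≤∣p∣⇒nonempty p (≤-pred 2≤∣p∣) in zero , suc y , 0≢1+n , here , there y∈p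
2≤∣p∣⇒two-members (outside ∷ p) 2≤∣p∣ =
  let x , y , x≢y , x∈p , y∈p = 2≤∣p∣⇒two-members p 2≤∣p∣
  in  suc x , suc y , x≢y ∘ suc-injective , there x∈p , there y∈p

two-members⇒2≤∣p∣ : ∀ {n} {p : Subset n} {x y} → x ≢ y → x ∈ p → y ∈ p → 2 ≤ ∣ p ∣
two-members⇒2≤∣p∣ x≢y x∈p y∈p =
  ≤-trans (s≤s (≤-trans (s≤s z≤n) (x∈p⇒∣p-x∣<∣p∣ (x∈p∧x≢y⇒x∈p-y y∈p (x≢y ∘ ≡.sym)))))
          (x∈p⇒∣p-x∣<∣p∣ x∈p)

∈-tabulate⁺ : ∀ {n} {f : Fin n → Bool} {x} → T (f x) → x ∈ Vec.tabulate f
∈-tabulate⁺ {f = f} {x} fx =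
  lookup⇒[]= x (Vec.tabulate f) (≡.trans (lookup∘tabulate f x) (Equivalence.to T-≡ fx))

∈-tabulate⁻ : ∀ {n} {f : Fin n → Bool} {x} → x ∈ Vec.tabulate f → T (f x)
∈-tabulate⁻ {f = f} {x} x∈ =
  Equivalence.from T-≡ (≡.trans (≡.sym (lookup∘tabulate f x)) ([]=⇒lookup x∈))

lookup-pair-injective : ∀ {A : Set} {x y : A} → x ≢ y → Injective _≡_ _≡_ (Vec.lookup (x ∷ y ∷ []))
lookup-pair-injective x≢y {zero}     {zero}     _   = refl
lookup-pair-injective x≢y {zero}     {suc zero} x≡y = ⊥-elim (x≢y x≡y)
lookup-pair-injective x≢y {suc zero} {zero}     y≡x = ⊥-elim (x≢y (≡.sym y≡x))
lookup-pair-injective x≢y {suc zero} {suc zero} _   = refl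

ordered-pair-determined : ∀ {A : Set} {_≺_ : A → A → Set} → Asymmetric _≺_ →
  ∀ {a b i j i′ j′} → a ≢ b → a ≡ i ⊎ a ≡ j → b ≡ i ⊎ b ≡ j → a ≡ i′ ⊎ a ≡ j′ → b ≡ i′ ⊎ b ≡ j′ →
  i ≺ j → i′ ≺ j′ → i ≡ i′ × j ≡ j′
ordered-pair-determined _ a≢b (inj₁ refl) (inj₁ refl) _ _ _ _ = ⊥-elim (a≢b refl)
ordered-pair-determined _ a≢b (inj₂ refl) (inj₂ refl) _ _ _ _ = ⊥-elim (a≢b refl)
ordered-pair-determined _ a≢b _ _ (inj₁ refl) (inj₁ refl) _ _ = ⊥-elim (a≢b refl)
ordered-pair-determined _ a≢b _ _ (inj₂ refl) (inj₂ refl) _ _ = ⊥-elim (a≢b refl)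
ordered-pair-determined _ _ (inj₁ refl) (inj₂ refl) (inj₁ refl) (inj₂ refl) _ _ = refl , refl
ordered-pair-determined _ _ (inj₂ refl) (inj₁ refl) (inj₂ refl) (inj₁ refl) _ _ = refl , refl
ordered-pair-determined asym _ (inj₁ refl) (inj₂ refl) (inj₂ refl) (inj₁ refl) i≺j j≺i =
  ⊥-elim (asym i≺j j≺i)
ordered-pair-determined asym _ (inj₂ refl) (inj₁ refl) (inj₁ refl) (inj₂ refl) i≺j j≺i =
  ⊥-elim (asym i≺j j≺i)

module _ {n} (G : Graph n) where

  infix 4 _∼_
  _∼_ : Fin n → Fin n → Set
  v ∼ w = T (adj G v w)

  ∼-sym : ∀ {v w} → v ∼ w → w ∼ v
  ∼-sym {v} {w} = subst T (sym G v w)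

  ∼-irrefl : ∀ {v} → ¬ v ∼ v
  ∼-irrefl {v} = subst T (irrefl G v)

  Neighbour : Fin n → Set
  Neighbour v = Σ[ w ∈ Fin n ] v ∼ w

  Fin-degree↔Neighbour : ∀ v → Fin (degree G v) ↔ Neighbour v
  Fin-degree↔Neighbour v = Fin-countTrue↔Σ (adj G v)

  degree≡0⇒isolated : ∀ {v w} → degree G v ≡ 0 → ¬ v ∼ w
  degree≡0⇒isolated {v} {w} deg≡0 v∼w =
    ¬Fin0 (subst Fin deg≡0 (Inverse.from (Fin-degree↔Neighbour v) (w , v∼w)))

  degree≡1⇒unique-neighbour : ∀ {v} → degree G v ≡ 1 →
                              Σ[ u ∈ Fin n ] v ∼ u × (∀ {w} → v ∼ w → w ≡ u)
  degree≡1⇒unique-neighbour {v} deg≡1 =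
    proj₁ neighbour , proj₂ neighbour ,
    λ v∼w → cong proj₁ (Fin1↔⇒all-equal Fin1↔Neighbour (_ , v∼w) neighbour)
    where
    Fin1↔Neighbour : Fin 1 ↔ Neighbour v
    Fin1↔Neighbour = subst (λ d → Fin d ↔ Neighbour v) deg≡1 (Fin-degree↔Neighbour v)
    neighbour : Neighbour v
    neighbour = Inverse.to Fin1↔Neighbour zero

  bipartite⇒triangle-free : Bipartite G → ∀ {u v w} → u ∼ v → v ∼ w → ¬ u ∼ w
  bipartite⇒triangle-free (colour , proper) {u} {v} {w} u∼v v∼w u∼w =
    proper u w (Equivalence.to T-≡ u∼w) (begin
      colour u             ≡⟨ ¬-not (proper u v (Equivalence.to T-≡ u∼v)) ⟩
      not (colour v)       ≡⟨ cong not (¬-not (proper v w (Equivalence.to T-≡ v∼w))) ⟩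
      not (not (colour w)) ≡⟨ not-involutive (colour w) ⟩
      colour w             ∎)
    where open ≡.≡-Reasoning

  OrderedEdge : Fin n → Fin n → Set
  OrderedEdge i j = T ((toℕ i <ᵇ toℕ j) ∧ adj G i j)

  orderedEdge⁺ : ∀ {i j} → i < j → i ∼ j → OrderedEdge i j
  orderedEdge⁺ i<j i∼j = Equivalence.from T-∧ (<⇒<ᵇ i<j , i∼j)

  orderedEdge⇒< : ∀ {i j} → OrderedEdge i j → i < j
  orderedEdge⇒< {i} {j} t = <ᵇ⇒< (toℕ i) (toℕ j) (proj₁ (Equivalence.to T-∧ t))

  orderedEdge⇒∼ : ∀ {i j} → OrderedEdge i j → i ∼ j
  orderedEdge⇒∼ t = proj₂ (Equivalence.to T-∧ t)

  Edge : Set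
  Edge = Σ[ i ∈ Fin n ] Σ[ j ∈ Fin n ] OrderedEdge i j

  infix 4 _∈ₑ_
  _∈ₑ_ : Fin n → Edge → Set
  v ∈ₑ (i , j , _) = v ≡ i ⊎ v ≡ j

  edge-determined : ∀ {a b} (e e′ : Edge) → a ≢ b →
                    a ∈ₑ e → b ∈ₑ e → a ∈ₑ e′ → b ∈ₑ e′ → e ≡ e′
  edge-determined (i , j , t) (i′ , j′ , t′) a≢b a∈e b∈e a∈e′ b∈e′
    with ordered-pair-determined <-asym a≢b a∈e b∈e a∈e′ b∈e′ (orderedEdge⇒< t) (orderedEdge⇒< t′)
  ... | refl , refl = cong (λ t → i , j , t) (T-irrelevant t t′)

  edge-between : ∀ {v w} → v ∼ w → Σ[ e ∈ Edge ] (∀ {u} → u ∈ₑ e ⇔ (u ≡ v ⊎ u ≡ w))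
  edge-between {v} {w} v∼w with <-cmp v w
  ... | tri< v<w _ _  = (v , w , orderedEdge⁺ v<w v∼w) , mk⇔ id id
  ... | tri≈ _ refl _ = ⊥-elim (∼-irrefl v∼w)
  ... | tri> _ _ w<v  = (w , v , orderedEdge⁺ w<v (∼-sym v∼w)) , mk⇔ swap swap

  Spare : Set
  Spare = Σ[ v ∈ Fin n ] Fin (2 ∸ degree G v)

  Point : Set
  Point = Edge ⊎ Spare

  Fin-edgeCount↔Edge : Fin (edgeCount G) ↔ Edge
  Fin-edgeCount↔Edge = ↔-trans (Fin-sum↔Σ _) (congˡ (Fin-countTrue↔Σ _))

  Fin[m+l+2e]↔Point : Fin (edgeCount G + leafCount G + 2 * isolatedCount G) ↔ Point
  Fin[m+l+2e]↔Point = subst (λ N → Fin N ↔ Point) (≡.sym points≡)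
    (↔-trans +↔⊎ (⊎-cong Fin-edgeCount↔Edge (Fin-sum↔Σ (λ v → 2 ∸ degree G v))))
    where
    points≡ : edgeCount G + leafCount G + 2 * isolatedCount G ≡
              edgeCount G + sum (map (λ v → 2 ∸ degree G v) (allFin n))
    points≡ = ≡.trans (+-assoc (edgeCount G) _ _)
                      (cong (edgeCount G +_) (≡.sym (sum-2∸≡countTrue (degree G) (allFin n))))

  -- Lines are indexed by the vertices themselves, and x ∈ℓ v says that the point x lies on the
  -- line of v; distinctness of the lines is not a field, as it follows from two-points and
  -- pair-determines-line.
  record LinearRepresentation (X : Set) : Set₁ where
    field
      _∈ℓ_                 : X → Fin n → Set
      two-points           : ∀ v → ∃₂ λ x y → x ≢ y × x ∈ℓ v × y ∈ℓ v
      pair-determines-line : ∀ {x y v w} → x ≢ y → x ∈ℓ v → y ∈ℓ v → x ∈ℓ w → y ∈ℓ w → v ≡ w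
      meet⇒adjacent        : ∀ {x v w} → v ≢ w → x ∈ℓ v → x ∈ℓ w → v ∼ w
      adjacent⇒meet        : ∀ {v w} → v ∼ w → ∃ λ x → x ∈ℓ v × x ∈ℓ w

  realizable⇒representation : ∀ {p} → RealizableOn p G → LinearRepresentation (Fin p)
  realizable⇒representation {p} (k , H , φ , realizes) = record
    { _∈ℓ_                 = _∈ℓ_
    ; two-points           = λ v → 2≤∣p∣⇒two-members (line H (from v)) (size H (from v))
    ; pair-determines-line = pair-determines-line
    ; meet⇒adjacent        = meet⇒adjacent
    ; adjacent⇒meet        = adjacent⇒meet
    }
    where
    open Inverse φ using (to; from; strictlyInverseˡ)

    _∈ℓ_ : Fin p → Fin n → Set
    x ∈ℓ v = x ∈ line H (from v)

    pair-determines-line : ∀ {x y v w} → x ≢ y → x ∈ℓ v → y ∈ℓ v → x ∈ℓ w → y ∈ℓ w → v ≡ w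
    pair-determines-line x≢y x∈v y∈v x∈w y∈w =
      from-injective φ (linear H _ _ x≢y _ _ x∈v y∈v x∈w y∈w)

    adj-to∘from : ∀ v w → adj G (to (from v)) (to (from w)) ≡ adj G v w
    adj-to∘from v w = cong₂ (adj G) (strictlyInverseˡ v) (strictlyInverseˡ w)

    meet⇒adjacent : ∀ {x v w} → v ≢ w → x ∈ℓ v → x ∈ℓ w → v ∼ w
    meet⇒adjacent {x} {v} {w} v≢w x∈v x∈w = Equivalence.from T-≡
      (≡.trans (≡.sym (adj-to∘from v w))
               (proj₁ (realizes (from v) (from w)) (v≢w ∘ from-injective φ , x , x∈v , x∈w)))

    adjacent⇒meet : ∀ {v w} → v ∼ w → ∃ λ x → x ∈ℓ v × x ∈ℓ w
    adjacent⇒meet {v} {w} v∼w =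
      proj₂ (proj₂ (realizes (from v) (from w))
                   (≡.trans (adj-to∘from v w) (Equivalence.to T-≡ v∼w)))

  representation⇒realizable : ∀ {X p} (ρ : LinearRepresentation X) →
                              (∀ x v → Dec (LinearRepresentation._∈ℓ_ ρ x v)) → X ↔ Fin p →
                              RealizableOn p G
  representation⇒realizable {X} {p} ρ _∈ℓ?_ X↔Fin =
    n , H , ↔-refl , λ v w → meets⇒adjacent , adjacent⇒meets
    where
    open LinearRepresentation ρ
    open Inverse X↔Fin using (to; from; strictlyInverseʳ)

    lineOf : Fin n → Subset p
    lineOf v = Vec.tabulate (λ y → isYes (from y ∈ℓ? v))

    ∈lineOf⁻ : ∀ {y v} → y ∈ lineOf v → from y ∈ℓ v
    ∈lineOf⁻ y∈v = toWitness (∈-tabulate⁻ y∈v)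

    ∈lineOf⁺ : ∀ {x v} → x ∈ℓ v → to x ∈ lineOf v
    ∈lineOf⁺ {x} {v} x∈v =
      ∈-tabulate⁺ (fromWitness (subst (_∈ℓ v) (≡.sym (strictlyInverseʳ x)) x∈v))

    lineOf-injective : ∀ v w → lineOf v ≡ lineOf w → v ≡ w
    lineOf-injective v w eq =
      let x , y , x≢y , x∈v , y∈v = two-points v
      in  pair-determines-line x≢y x∈v y∈v (on-w x∈v) (on-w y∈v)
      where
      on-w : ∀ {x} → x ∈ℓ v → x ∈ℓ w
      on-w {x} x∈v =
        subst (_∈ℓ w) (strictlyInverseʳ x) (∈lineOf⁻ (subst (to x ∈_) eq (∈lineOf⁺ x∈v)))

    2≤∣lineOf∣ : ∀ v → 2 ≤ ∣ lineOf v ∣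
    2≤∣lineOf∣ v =
      let x , y , x≢y , x∈v , y∈v = two-points v
      in  two-members⇒2≤∣p∣ (x≢y ∘ to-injective X↔Fin) (∈lineOf⁺ x∈v) (∈lineOf⁺ y∈v)

    H : LinHyp p n
    H = record
      { line     = lineOf
      ; distinct = lineOf-injective
      ; size     = 2≤∣lineOf∣
      ; linear   = λ y y′ y≢y′ v w y∈v y′∈v y∈w y′∈w →
                     pair-determines-line (y≢y′ ∘ from-injective X↔Fin)
                       (∈lineOf⁻ y∈v) (∈lineOf⁻ y′∈v) (∈lineOf⁻ y∈w) (∈lineOf⁻ y′∈w)
      }

    meets⇒adjacent : ∀ {v w} → Meets H v w → adj G v w ≡ true
    meets⇒adjacent (v≢w , y , y∈v , y∈w) =
      Equivalence.to T-≡ (meet⇒adjacent v≢w (∈lineOf⁻ y∈v) (∈lineOf⁻ y∈w))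

    adjacent⇒meets : ∀ {v w} → adj G v w ≡ true → Meets H v w
    adjacent⇒meets adj≡true =
      let v∼w = Equivalence.from T-≡ adj≡true
          x , x∈v , x∈w = adjacent⇒meet v∼w
      in  (λ { refl → ∼-irrefl v∼w }) , to x , ∈lineOf⁺ x∈v , ∈lineOf⁺ x∈w

  infix 4 _lies-on_ _lies-on?_
  _lies-on_ : Point → Fin n → Set
  inj₁ e       lies-on v = v ∈ₑ e
  inj₂ (u , _) lies-on v = v ≡ u

  _lies-on?_ : ∀ q v → Dec (q lies-on v)
  inj₁ (i , j , _) lies-on? v = (v ≟ i) ⊎-dec (v ≟ j)
  inj₂ (u , _)     lies-on? v = v ≟ u

  incidence : ∀ v → Neighbour v ⊎ Fin (2 ∸ degree G v) → Point
  incidence v (inj₁ (_ , v∼w)) = inj₁ (proj₁ (edge-between v∼w))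
  incidence v (inj₂ a)         = inj₂ (v , a)

  incidence-lies-on : ∀ v z → incidence v z lies-on v
  incidence-lies-on v (inj₁ (_ , v∼w)) = Equivalence.from (proj₂ (edge-between v∼w)) (inj₁ refl)
  incidence-lies-on v (inj₂ _)         = refl

  edge-between-injective : ∀ {v w w′} (v∼w : v ∼ w) (v∼w′ : v ∼ w′) →
                           proj₁ (edge-between v∼w) ≡ proj₁ (edge-between v∼w′) → w′ ≡ w
  edge-between-injective v∼w v∼w′ eq
    with Equivalence.to (proj₂ (edge-between v∼w))
           (subst (_ ∈ₑ_) (≡.sym eq) (Equivalence.from (proj₂ (edge-between v∼w′)) (inj₂ refl)))
  ... | inj₁ refl = ⊥-elim (∼-irrefl v∼w′)
  ... | inj₂ w′≡w = w′≡w

  incidence-injective : ∀ v → Injective _≡_ _≡_ (incidence v)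
  incidence-injective v {inj₁ (w , v∼w)} {inj₁ (_ , v∼w′)} eq
    with edge-between-injective v∼w v∼w′ (inj₁-injective eq)
  ... | refl = cong (λ t → inj₁ (w , t)) (T-irrelevant v∼w v∼w′)
  incidence-injective v {inj₁ _} {inj₂ _} ()
  incidence-injective v {inj₂ _} {inj₁ _} ()
  incidence-injective v {inj₂ _} {inj₂ _} refl = refl

  canonical-two-points : ∀ v → ∃₂ λ q q′ → q ≢ q′ × q lies-on v × q′ lies-on v
  canonical-two-points v =
    let a , b , fa≢fb = injective⇒two-values f-injective (m≤n+m∸n 2 (degree G v))
    in  f a , f b , fa≢fb , incidence-lies-on v _ , incidence-lies-on v _
    where
    split : Fin (degree G v + (2 ∸ degree G v)) ↔ (Neighbour v ⊎ Fin (2 ∸ degree G v))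
    split = ↔-trans +↔⊎ (⊎-cong (Fin-degree↔Neighbour v) ↔-refl)
    f : Fin (degree G v + (2 ∸ degree G v)) → Point
    f = incidence v ∘ Inverse.to split
    f-injective : Injective _≡_ _≡_ f
    f-injective = to-injective split ∘ incidence-injective v

  shared-point-unique : ∀ {v w q q′} → v ≢ w →
                        q lies-on v → q lies-on w → q′ lies-on v → q′ lies-on w → q ≡ q′
  shared-point-unique {q = inj₁ e} {inj₁ e′} v≢w e∋v e∋w e′∋v e′∋w =
    cong inj₁ (edge-determined e e′ v≢w e∋v e∋w e′∋v e′∋w)
  shared-point-unique {q = inj₂ _}  v≢w refl refl _ _ = ⊥-elim (v≢w refl)
  shared-point-unique {q′ = inj₂ _} v≢w _ _ refl refl = ⊥-elim (v≢w refl)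

  canonical-pair-determines-line : ∀ {q q′ v w} → q ≢ q′ →
                                   q lies-on v → q′ lies-on v → q lies-on w → q′ lies-on w → v ≡ w
  canonical-pair-determines-line {v = v} {w} q≢q′ q∋v q′∋v q∋w q′∋w with v ≟ w
  ... | yes v≡w = v≡w
  ... | no v≢w  = ⊥-elim (q≢q′ (shared-point-unique v≢w q∋v q∋w q′∋v q′∋w))

  canonical-meet⇒adjacent : ∀ {q v w} → v ≢ w → q lies-on v → q lies-on w → v ∼ w
  canonical-meet⇒adjacent {inj₁ (_ , _ , t)} _   (inj₁ refl) (inj₂ refl) = orderedEdge⇒∼ t
  canonical-meet⇒adjacent {inj₁ (_ , _ , t)} _   (inj₂ refl) (inj₁ refl) = ∼-sym (orderedEdge⇒∼ t)
  canonical-meet⇒adjacent {inj₁ _}           v≢w (inj₁ refl) (inj₁ refl) = ⊥-elim (v≢w refl)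
  canonical-meet⇒adjacent {inj₁ _}           v≢w (inj₂ refl) (inj₂ refl) = ⊥-elim (v≢w refl)
  canonical-meet⇒adjacent {inj₂ _}           v≢w refl        refl        = ⊥-elim (v≢w refl)

  canonical-adjacent⇒meet : ∀ {v w} → v ∼ w → ∃ λ q → q lies-on v × q lies-on w
  canonical-adjacent⇒meet v∼w =
    let e , ends = edge-between v∼w
    in  inj₁ e , Equivalence.from ends (inj₁ refl) , Equivalence.from ends (inj₂ refl)

  canonical-representation : LinearRepresentation Point
  canonical-representation = record
    { _∈ℓ_                 = _lies-on_
    ; two-points           = canonical-two-points
    ; pair-determines-line = canonical-pair-determines-line
    ; meet⇒adjacent        = canonical-meet⇒adjacent
    ; adjacent⇒meet        = canonical-adjacent⇒meet
    }

  module _ {X : Set} (ρ : LinearRepresentation X) (_≟ₓ_ : DecidableEquality X) where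
    open LinearRepresentation ρ

    Private : Fin n → X → Set
    Private v x = x ∈ℓ v × (∀ {w} → x ∈ℓ w → w ≡ v)

    record PrivatePoints (v : Fin n) (m : ℕ) : Set where
      field
        point           : Fin m → X
        point-injective : Injective _≡_ _≡_ point
        point-private   : ∀ a → Private v (point a)
    open PrivatePoints

    lies-on-two⇒adjacent : ∀ {x v w} → x ∈ℓ v → x ∈ℓ w → w ≡ v ⊎ v ∼ w
    lies-on-two⇒adjacent {v = v} {w} x∈v x∈w with w ≟ v
    ... | yes w≡v = inj₁ w≡v
    ... | no w≢v  = inj₂ (meet⇒adjacent (w≢v ∘ ≡.sym) x∈v x∈w)

    isolated-private : ∀ {v x} → degree G v ≡ 0 → x ∈ℓ v → Private v x
    isolated-private deg≡0 x∈v =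
      x∈v , λ x∈w → [ id , ⊥-elim ∘ degree≡0⇒isolated deg≡0 ]′ (lies-on-two⇒adjacent x∈v x∈w)

    leaf-private : ∀ {v u c x} → (∀ {w} → v ∼ w → w ≡ u) → c ∈ℓ v → c ∈ℓ u → x ≢ c → x ∈ℓ v →
                   Private v x
    leaf-private {v} {u} {c} {x} only-u c∈v c∈u x≢c x∈v =
      x∈v , λ x∈w → [ id , ⊥-elim ∘ not-neighbour x∈w ]′ (lies-on-two⇒adjacent x∈v x∈w)
      where
      not-neighbour : ∀ {w} → x ∈ℓ w → ¬ v ∼ w
      not-neighbour {w} x∈w v∼w = ∼-irrefl (subst (v ∼_) (≡.sym v≡w) v∼w)
        where
        v≡w : v ≡ w
        v≡w = pair-determines-line x≢c x∈v c∈v x∈w (subst (c ∈ℓ_) (≡.sym (only-u v∼w)) c∈u)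

    single-private-point : ∀ {v x} → Private v x → PrivatePoints v 1
    single-private-point {x = x} x-private = record
      { point           = λ _ → x
      ; point-injective = λ { {zero} {zero} _ → refl }
      ; point-private   = λ _ → x-private
      }

    isolated-private-points : ∀ {v} → degree G v ≡ 0 → PrivatePoints v 2
    isolated-private-points {v} deg≡0 with two-points v
    ... | x , y , x≢y , x∈v , y∈v = record
      { point           = Vec.lookup (x ∷ y ∷ [])
      ; point-injective = lookup-pair-injective x≢y
      ; point-private   = λ { zero       → isolated-private deg≡0 x∈v
                            ; (suc zero) → isolated-private deg≡0 y∈v }
      }

    leaf-private-point : ∀ {v} → degree G v ≡ 1 → PrivatePoints v 1
    leaf-private-point {v} deg≡1 with degree≡1⇒unique-neighbour deg≡1
    ... | u , v∼u , only-u with adjacent⇒meet v∼u | two-points v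
    ... | c , c∈v , c∈u | x , y , x≢y , x∈v , y∈v with x ≟ₓ c
    ... | no x≢c  = single-private-point (leaf-private only-u c∈v c∈u x≢c x∈v)
    ... | yes refl = single-private-point (leaf-private only-u c∈v c∈u (x≢y ∘ ≡.sym) y∈v)

    private-points : ∀ v → PrivatePoints v (2 ∸ degree G v)
    private-points v with degree G v in deg
    ... | 0           = isolated-private-points deg
    ... | 1           = leaf-private-point deg
    ... | suc (suc k) = subst (PrivatePoints v) (≡.sym (0∸n≡0 k)) no-private-points
      where
      no-private-points : PrivatePoints v 0
      no-private-points = record
        { point = λ () ; point-injective = λ {a} → ⊥-elim (¬Fin0 a) ; point-private = λ () }

    bipartite⇒no-point-on-three-lines : Bipartite G → ∀ {x i j k} → i ≢ j →
                                        x ∈ℓ i → x ∈ℓ j → x ∈ℓ k → k ≡ i ⊎ k ≡ j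
    bipartite⇒no-point-on-three-lines bipartite {i = i} {j} {k} i≢j x∈i x∈j x∈k
      with k ≟ i | k ≟ j
    ... | yes k≡i | _       = inj₁ k≡i
    ... | no _    | yes k≡j = inj₂ k≡j
    ... | no k≢i  | no k≢j  = ⊥-elim (bipartite⇒triangle-free bipartite
            (meet⇒adjacent i≢j x∈i x∈j)
            (meet⇒adjacent (k≢j ∘ ≡.sym) x∈j x∈k)
            (meet⇒adjacent (k≢i ∘ ≡.sym) x∈i x∈k))

    edge-point : (e : Edge) → Σ[ x ∈ X ] (∀ {u} → u ∈ₑ e → x ∈ℓ u)
    edge-point (_ , _ , t) =
      let x , x∈i , x∈j = adjacent⇒meet (orderedEdge⇒∼ t)
      in  x , λ { (inj₁ refl) → x∈i ; (inj₂ refl) → x∈j }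

    edge-point-not-private : ∀ {v} (e : Edge) → ¬ Private v (proj₁ (edge-point e))
    edge-point-not-private e@(_ , _ , t) (_ , only-v) =
      <⇒≢ (orderedEdge⇒< t) (≡.trans (only-v (on (inj₁ refl))) (≡.sym (only-v (on (inj₂ refl)))))
      where
      on : ∀ {u} → u ∈ₑ e → proj₁ (edge-point e) ∈ℓ u
      on = proj₂ (edge-point e)

    embed : Point → X
    embed (inj₁ e)       = proj₁ (edge-point e)
    embed (inj₂ (v , a)) = point (private-points v) a

    embed-injective : Bipartite G → Injective _≡_ _≡_ embed
    embed-injective bipartite {inj₁ e@(_ , _ , t)} {inj₁ e′@(_ , _ , t′)} eq =
      cong inj₁ (edge-determined e e′ (<⇒≢ (orderedEdge⇒< t′))
                                 (on-e (inj₁ refl)) (on-e (inj₂ refl)) (inj₁ refl) (inj₂ refl))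
      where
      on-e : ∀ {u} → u ∈ₑ e′ → u ∈ₑ e
      on-e u∈e′ = bipartite⇒no-point-on-three-lines bipartite (<⇒≢ (orderedEdge⇒< t))
        (proj₂ (edge-point e) (inj₁ refl)) (proj₂ (edge-point e) (inj₂ refl))
        (subst (_∈ℓ _) (≡.sym eq) (proj₂ (edge-point e′) u∈e′))
    embed-injective _ {inj₁ e} {inj₂ (v , a)} eq = ⊥-elim (edge-point-not-private e
      (subst (Private v) (≡.sym eq) (point-private (private-points v) a)))
    embed-injective _ {inj₂ (v , a)} {inj₁ e} eq = ⊥-elim (edge-point-not-private e
      (subst (Private v) eq (point-private (private-points v) a)))
    embed-injective _ {inj₂ (v , a)} {inj₂ (w , b)} eq
      with proj₂ (point-private (private-points w) b)
                 (subst (_∈ℓ v) eq (proj₁ (point-private (private-points v) a)))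
    ... | refl = cong (λ a → inj₂ (v , a)) (point-injective (private-points v) eq)

mainTheorem15 : ∀ n (G : Graph n) → Bipartite G →
    IsV G (edgeCount G + leafCount G + 2 * isolatedCount G)
mainTheorem15 n G bipartite = realizable , minimal
  where
  Fin↔Point : Fin (edgeCount G + leafCount G + 2 * isolatedCount G) ↔ Point G
  Fin↔Point = Fin[m+l+2e]↔Point G

  realizable : RealizableOn (edgeCount G + leafCount G + 2 * isolatedCount G) G
  realizable = representation⇒realizable G (canonical-representation G) (_lies-on?_ G)
                 (↔-sym Fin↔Point)

  minimal : ∀ p → RealizableOn p G → edgeCount G + leafCount G + 2 * isolatedCount G ≤ p
  minimal p realizable-on-p =
    injective⇒≤ (to-injective Fin↔Point ∘ embed-injective G ρ _≟_ bipartite)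
    where
    ρ : LinearRepresentation G (Fin p)
    ρ = realizable⇒representation G realizable-on-p
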